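{- Let $G^{\alpha}$, $\alpha\in\{0,1\}^4$, be complex numbers. Assume that the $4\times 4$ matrix \begin{equation*} A=\begin{pmatrix} G^{0000}&0&0&G^{0011}\\ 0&G^{0101}&G^{0110}&0\\ 0&G^{1001}&G^{1010}&0\\ G^{1100}&0&0&G^{1111} \end{pmatrix} \end{equation*} has rank 4 and that \begin{equation*} G^{0000}G^{1111}-G^{1100}G^{0011}=\pm\left(G^{1010}G^{0101}-G^{1001}G^{0110}\right). \end{equation*} Then the inverse matrix $A^{ -1}$ is of the form \begin{equation*} A^{ -1}=\begin{pmatrix} g^{0000}&0&0&g^{0011}\\ 0&g^{0101}&g^{0110}&0\\ 0&g^{1001}&g^{1010}&0\\ g^{1100}&0&0&g^{1111} \end{pmatrix} \end{equation*} for some complex numbers $g^{\alpha}$, and these satisfy \begin{equation*} g^{0000}g^{1111}-g^{1100}g^{0011}=\pm\left(g^{1010}g^{0101}-g^{1001}g^{0110}\right), \end{equation*} with the same sign $\pm$ as in the hypothesis on the $G^{\alpha}$.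
   Context: This is a group property of standard signatures of arity 4: for an even matchgate of arity 4, the standard signature $G$ vanishes on odd-weight indices and the only nontrivial matchgate identity is $G^{0000}G^{1111}-G^{1100}G^{0011}+G^{1010}G^{0101}-G^{1001}G^{0110}=0$; the sign $\pm$ accounts for the ordering of the 4 bits relative to this identity. (In the paper the inverse is written $G^{ -1}$, meaning the inverse of the matrix $A$.) -}

module Defs where

open import Level using (Level; _⊔_) renaming (suc to lsuc)
open import Data.Bool using (Bool; true; false)
open import Data.Fin using (Fin; zero; suc)
open import Data.Product using (Σ; _×_)
open import Data.Sign using (Sign)
open import Relation.Nullary using (¬_)
open import Algebra.Bundles using (CommutativeRing)

record Field (c ℓ : Level) : Set (lsuc (c ⊔ ℓ)) where
  field
    commutativeRing : CommutativeRing c ℓ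
  open CommutativeRing commutativeRing public
  field
    0≉1 : ¬ (0# ≈ 1#)
    inverse : ∀ x → ¬ (x ≈ 0#) → Σ Carrier λ y → x * y ≈ 1#

module FieldDefs {c ℓ} (F : Field c ℓ) where
  open Field F public using (Carrier; _≈_; 0#; 1#; _+_; _*_; -_; _-_)

  -- a bit: false = 0, true = 1
  Bit : Set
  Bit = Bool

  -- a signature G^{α}, α ∈ {0,1}^4, as a function of the four bits
  Sig : Set c
  Sig = Bit → Bit → Bit → Bit → Carrier

  Mat : Set c
  Mat = Fin 4 → Fin 4 → Carrier

  blockMat : Sig → Mat
  blockMat G zero zero = G false false false false
  blockMat G zero (suc (suc (suc zero))) = G false false true true
  blockMat G (suc zero) (suc zero) = G false true false true
  blockMat G (suc zero) (suc (suc zero)) = G false true true false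
  blockMat G (suc (suc zero)) (suc zero) = G true false false true
  blockMat G (suc (suc zero)) (suc (suc zero)) = G true false true false
  blockMat G (suc (suc (suc zero))) zero = G true true false false
  blockMat G (suc (suc (suc zero))) (suc (suc (suc zero))) = G true true true true
  blockMat G _ _ = 0#

  _·_ : Mat → Mat → Mat
  (M · N) i j = (M i zero * N zero j) + (M i (suc zero) * N (suc zero) j)
              + (M i (suc (suc zero)) * N (suc (suc zero)) j)
              + (M i (suc (suc (suc zero))) * N (suc (suc (suc zero))) j)

  I : Mat
  I zero zero = 1#
  I (suc zero) (suc zero) = 1#
  I (suc (suc zero)) (suc (suc zero)) = 1#
  I (suc (suc (suc zero))) (suc (suc (suc zero))) = 1#
  I _ _ = 0#

  _≋_ : Mat → Mat → Set ℓ
  M ≋ N = ∀ i j → M i j ≈ N i j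

  IsInverse : Mat → Mat → Set ℓ
  IsInverse M N = (M · N) ≋ I × (N · M) ≋ I

  applySign : Sign → Carrier → Carrier
  applySign Sign.+ x = x
  applySign Sign.- x = - x

  outerDet : Sig → Carrier
  outerDet G = (G false false false false * G true true true true)
             - (G true true false false * G false false true true)

  innerDet : Sig → Carrier
  innerDet G = (G true false true false * G false true false true)
             - (G true false false true * G false true true false)

module Submission where

-- With rows and columns reordered as 0, 3, 1, 2, A is block diagonal with the 2 × 2 blocks
-- P = [[G⁰⁰⁰⁰, G⁰⁰¹¹], [G¹¹⁰⁰, G¹¹¹¹]] and Q = [[G⁰¹⁰¹, G⁰¹¹⁰], [G¹⁰⁰¹, G¹⁰¹⁰]], whose
-- determinants are the two sides of the hypothesis. From A B = 1 the corresponding blocks of B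
-- are right inverses of P and Q, and from B A = 1 the off-block entries of B vanish (a row vector
-- killed by a block with a right inverse is zero), so B has the same shape. By Cauchy–Binet the
-- determinants of the blocks of B are inverse to those of A, and inverting D = ±D′ gives
-- D⁻¹ = ±D′⁻¹.

open import Defs
open import Data.Bool using (true; false)
open import Data.Fin using (Fin; zero; suc)
open import Data.Product using (Σ; Σ-syntax; _×_; _,_)
open import Data.Sign using (Sign)
open import Function using (_∘_)
open import Algebra.Bundles using (CommutativeRing)
import Algebra.Properties.Ring as RingProperties
import Algebra.Solver.Ring.NaturalCoefficients.Default as SemiringSolver
import Relation.Binary.Reasoning.Setoid as SetoidReasoning

module CommutativeRingProperties {r ℓ} (R : CommutativeRing r ℓ) where
  open CommutativeRing R
  open RingProperties ring
    using (-‿distribˡ-*; -‿distribʳ-*; -‿involutive; -‿+-comm; ⁻¹-anti-homo‿-; x[y-z]≈xy-xz; [y-z]x≈yx-zx)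
  open SemiringSolver commutativeSemiring using (solve; _:=_; _:+_; _:*_; con)
  open SetoidReasoning setoid

  p+x≈q+y⇒p-q≈y-x : ∀ {p q x y} → p + x ≈ q + y → p - q ≈ y - x
  p+x≈q+y⇒p-q≈y-x {p} {q} {x} {y} p+x≈q+y = begin
    p - q                ≈⟨ sym (+-identityʳ (p - q)) ⟩
    (p - q) + 0#         ≈⟨ +-congˡ (sym (-‿inverseʳ x)) ⟩
    (p - q) + (x - x)    ≈⟨ solve 4 (λ p -q x -x → (p :+ -q) :+ (x :+ -x) := (p :+ x) :+ (-x :+ -q))
                              refl p (- q) x (- x) ⟩
    (p + x) + (- x - q)  ≈⟨ +-congʳ p+x≈q+y ⟩
    (q + y) + (- x - q)  ≈⟨ solve 4 (λ q y -x -q → (q :+ y) :+ (-x :+ -q) := (y :+ -x) :+ (q :+ -q))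
                              refl q y (- x) (- q) ⟩
    (y - x) + (q - q)    ≈⟨ +-congˡ (-‿inverseʳ q) ⟩
    (y - x) + 0#         ≈⟨ +-identityʳ (y - x) ⟩
    y - x                ∎

  [x-y][z-w]≈xz+yw-[xw+yz] : ∀ x y z w → (x - y) * (z - w) ≈ (x * z + y * w) - (x * w + y * z)
  [x-y][z-w]≈xz+yw-[xw+yz] x y z w = begin
    (x - y) * (z - w)                        ≈⟨ [y-z]x≈yx-zx (z - w) x y ⟩
    x * (z - w) - y * (z - w)                ≈⟨ +-cong (x[y-z]≈xy-xz x z w) (-‿cong (x[y-z]≈xy-xz y z w)) ⟩
    (x * z - x * w) - (y * z - y * w)        ≈⟨ +-congˡ (⁻¹-anti-homo‿- (y * z) (y * w)) ⟩
    (x * z - x * w) + (y * w - y * z)        ≈⟨ solve 4 (λ a -b c -d → (a :+ -b) :+ (c :+ -d) := (a :+ c) :+ (-b :+ -d))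
                                                  refl (x * z) (- (x * w)) (y * w) (- (y * z)) ⟩
    (x * z + y * w) + (- (x * w) - (y * z))  ≈⟨ +-congˡ (-‿+-comm (x * w) (y * z)) ⟩
    (x * z + y * w) - (x * w + y * z)        ∎

  [-x][-y]≈xy : ∀ x y → - x * - y ≈ x * y
  [-x][-y]≈xy x y = begin
    - x * - y    ≈⟨ sym (-‿distribˡ-* x (- y)) ⟩
    - (x * - y)  ≈⟨ -‿cong (sym (-‿distribʳ-* x y)) ⟩
    - - (x * y)  ≈⟨ -‿involutive (x * y) ⟩
    x * y        ∎

  p+0q+0r+s≈p+s : ∀ p q r s → p + 0# * q + 0# * r + s ≈ p + s
  p+0q+0r+s≈p+s = solve 4 (λ p q r s → p :+ con 0 :* q :+ con 0 :* r :+ s := p :+ s) refl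

  0p+q+r+0s≈q+r : ∀ p q r s → 0# * p + q + r + 0# * s ≈ q + r
  0p+q+r+0s≈q+r = solve 4 (λ p q r s → con 0 :* p :+ q :+ r :+ con 0 :* s := q :+ r) refl

  p0+q+r+s0≈q+r : ∀ p q r s → p * 0# + q + r + s * 0# ≈ q + r
  p0+q+r+s0≈q+r = solve 4 (λ p q r s → p :* con 0 :+ q :+ r :+ s :* con 0 := q :+ r) refl

  p+q0+r0+s≈p+s : ∀ p q r s → p + q * 0# + r * 0# + s ≈ p + s
  p+q0+r0+s≈p+s = solve 4 (λ p q r s → p :+ q :* con 0 :+ r :* con 0 :+ s := p :+ s) refl

  *-inverse-unique : ∀ {x y z} → x * y ≈ 1# → x * z ≈ 1# → y ≈ z
  *-inverse-unique {x} {y} {z} xy≈1 xz≈1 = begin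
    y            ≈⟨ sym (*-identityʳ y) ⟩
    y * 1#       ≈⟨ *-congˡ (sym xz≈1) ⟩
    y * (x * z)  ≈⟨ solve 3 (λ x y z → y :* (x :* z) := (x :* y) :* z) refl x y z ⟩
    (x * y) * z  ≈⟨ *-congʳ xy≈1 ⟩
    1# * z       ≈⟨ *-identityˡ z ⟩
    z            ∎

module Matrix₂ {r ℓ} (R : CommutativeRing r ℓ) where
  open CommutativeRing R hiding (zero)
  open CommutativeRingProperties R using (p+x≈q+y⇒p-q≈y-x; [x-y][z-w]≈xz+yw-[xw+yz])
  open RingProperties ring using (-0#≈0#)
  open SemiringSolver commutativeSemiring using (solve; _:=_; _:+_; _:*_)
  open SetoidReasoning setoid

  Row₂ : Set r
  Row₂ = Fin 2 → Carrier

  Mat₂ : Set r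
  Mat₂ = Fin 2 → Fin 2 → Carrier

  _⊙_ : Row₂ → Mat₂ → Row₂
  (v ⊙ M) j = v zero * M zero j + v (suc zero) * M (suc zero) j

  _⊗_ : Mat₂ → Mat₂ → Mat₂
  (M ⊗ N) i = M i ⊙ N

  1₂ : Mat₂
  1₂ zero zero = 1#
  1₂ (suc zero) (suc zero) = 1#
  1₂ _ _ = 0#

  _≋₂_ : Mat₂ → Mat₂ → Set ℓ
  M ≋₂ N = ∀ i j → M i j ≈ N i j

  det : Mat₂ → Carrier
  det M = M zero zero * M (suc zero) (suc zero) - M (suc zero) zero * M zero (suc zero)

  ⊙-congʳ : ∀ v {M N} → M ≋₂ N → ∀ j → (v ⊙ M) j ≈ (v ⊙ N) j
  ⊙-congʳ v M≋N j = +-cong (*-congˡ (M≋N zero j)) (*-congˡ (M≋N (suc zero) j))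

  ⊙-identityʳ : ∀ v j → (v ⊙ 1₂) j ≈ v j
  ⊙-identityʳ v zero = begin
    v zero * 1# + v (suc zero) * 0#  ≈⟨ +-cong (*-identityʳ (v zero)) (zeroʳ (v (suc zero))) ⟩
    v zero + 0#                      ≈⟨ +-identityʳ (v zero) ⟩
    v zero                           ∎
  ⊙-identityʳ v (suc zero) = begin
    v zero * 0# + v (suc zero) * 1#  ≈⟨ +-cong (zeroʳ (v zero)) (*-identityʳ (v (suc zero))) ⟩
    0# + v (suc zero)                ≈⟨ +-identityˡ (v (suc zero)) ⟩
    v (suc zero)                     ∎

  ⊙-assoc : ∀ v M N j → (v ⊙ (M ⊗ N)) j ≈ ((v ⊙ M) ⊙ N) j
  ⊙-assoc v M N j = solve 8
    (λ v₀ v₁ m₀₀ m₀₁ m₁₀ m₁₁ n₀ n₁ →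
      v₀ :* (m₀₀ :* n₀ :+ m₀₁ :* n₁) :+ v₁ :* (m₁₀ :* n₀ :+ m₁₁ :* n₁)
        := (v₀ :* m₀₀ :+ v₁ :* m₁₀) :* n₀ :+ (v₀ :* m₀₁ :+ v₁ :* m₁₁) :* n₁)
    refl (v zero) (v (suc zero)) (M zero zero) (M zero (suc zero)) (M (suc zero) zero)
         (M (suc zero) (suc zero)) (N zero j) (N (suc zero) j)

  ⊙-zeroˡ : ∀ {v} → (∀ k → v k ≈ 0#) → ∀ N j → (v ⊙ N) j ≈ 0#
  ⊙-zeroˡ v≈0 N j = begin
    _                                    ≈⟨ +-cong (*-congʳ (v≈0 zero)) (*-congʳ (v≈0 (suc zero))) ⟩
    0# * N zero j + 0# * N (suc zero) j  ≈⟨ +-cong (zeroˡ (N zero j)) (zeroˡ (N (suc zero) j)) ⟩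
    0# + 0#                              ≈⟨ +-identityʳ 0# ⟩
    0#                                   ∎

  vM≈0⇒v≈0 : ∀ {M N} → (M ⊗ N) ≋₂ 1₂ → ∀ v → (∀ j → (v ⊙ M) j ≈ 0#) → ∀ k → v k ≈ 0#
  vM≈0⇒v≈0 {M} {N} MN≈1 v vM≈0 k = begin
    v k                ≈⟨ sym (⊙-identityʳ v k) ⟩
    (v ⊙ 1₂) k         ≈⟨ sym (⊙-congʳ v MN≈1 k) ⟩
    (v ⊙ (M ⊗ N)) k    ≈⟨ ⊙-assoc v M N k ⟩
    ((v ⊙ M) ⊙ N) k    ≈⟨ ⊙-zeroˡ vM≈0 N k ⟩
    0#                 ∎

  det-cong : ∀ {M N} → M ≋₂ N → det M ≈ det N
  det-cong M≋N = +-cong (*-cong (M≋N zero zero) (M≋N (suc zero) (suc zero)))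
                        (-‿cong (*-cong (M≋N (suc zero) zero) (M≋N zero (suc zero))))

  det-1₂ : det 1₂ ≈ 1#
  det-1₂ = begin
    1# * 1# - 0# * 0#  ≈⟨ +-cong (*-identityˡ 1#) (-‿cong (zeroˡ 0#)) ⟩
    1# - 0#            ≈⟨ +-congˡ -0#≈0# ⟩
    1# + 0#            ≈⟨ +-identityʳ 1# ⟩
    1#                 ∎

  det-⊗ : ∀ M N → det (M ⊗ N) ≈ det M * det N
  det-⊗ M N = begin
    det (M ⊗ N)                                       ≈⟨ p+x≈q+y⇒p-q≈y-x cauchyBinet ⟩
    (a * d * (e * h) + c * b * (g * f))
      - (a * d * (g * f) + c * b * (e * h))           ≈⟨ sym ([x-y][z-w]≈xz+yw-[xw+yz] (a * d) (c * b) (e * h) (g * f)) ⟩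
    det M * det N                                     ∎
    where
    a = M zero zero
    b = M zero (suc zero)
    c = M (suc zero) zero
    d = M (suc zero) (suc zero)
    e = N zero zero
    f = N zero (suc zero)
    g = N (suc zero) zero
    h = N (suc zero) (suc zero)
    -- The Cauchy–Binet identity for 2 × 2 matrices with all subtractions moved across.
    cauchyBinet : (a * e + b * g) * (c * f + d * h) + (a * d * (g * f) + c * b * (e * h))
                ≈ (c * e + d * g) * (a * f + b * h) + (a * d * (e * h) + c * b * (g * f))
    cauchyBinet = solve 8
      (λ a b c d e f g h →
        (a :* e :+ b :* g) :* (c :* f :+ d :* h) :+ (a :* d :* (g :* f) :+ c :* b :* (e :* h))
          := (c :* e :+ d :* g) :* (a :* f :+ b :* h) :+ (a :* d :* (e :* h) :+ c :* b :* (g :* f)))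
      refl a b c d e f g h

  det*det≈1 : ∀ M N → (M ⊗ N) ≋₂ 1₂ → det M * det N ≈ 1#
  det*det≈1 M N MN≈1 = trans (sym (det-⊗ M N)) (trans (det-cong MN≈1) det-1₂)

module BlockMatrix {c ℓ} (F : Field c ℓ) where
  open Field F using (commutativeRing; refl; sym; trans; +-cong; *-cong; *-congʳ; *-comm)
  open FieldDefs F
  open CommutativeRingProperties commutativeRing
  open Matrix₂ commutativeRing

  outer inner : Fin 2 → Fin 4
  outer zero = zero
  outer (suc zero) = suc (suc (suc zero))
  inner zero = suc zero
  inner (suc zero) = suc (suc zero)

  block : (Fin 2 → Fin 4) → Mat → Mat₂
  block ι M i j = M (ι i) (ι j)

  signatureOf : Mat → Sig
  signatureOf M false false false false = M zero zero
  signatureOf M false false true  true  = M zero (suc (suc (suc zero)))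
  signatureOf M false true  false true  = M (suc zero) (suc zero)
  signatureOf M false true  true  false = M (suc zero) (suc (suc zero))
  signatureOf M true  false false true  = M (suc (suc zero)) (suc zero)
  signatureOf M true  false true  false = M (suc (suc zero)) (suc (suc zero))
  signatureOf M true  true  false false = M (suc (suc (suc zero))) zero
  signatureOf M true  true  true  true  = M (suc (suc (suc zero))) (suc (suc (suc zero)))
  signatureOf M _     _     _     _     = 0#

  off-blocks≈0⇒≋blockMat : ∀ M → (∀ i k → M (outer i) (inner k) ≈ 0#) → (∀ i k → M (inner i) (outer k) ≈ 0#) →
                           M ≋ blockMat (signatureOf M)
  off-blocks≈0⇒≋blockMat M oi≈0 io≈0 zero                   zero                   = refl
  off-blocks≈0⇒≋blockMat M oi≈0 io≈0 zero                   (suc zero)             = oi≈0 zero zero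
  off-blocks≈0⇒≋blockMat M oi≈0 io≈0 zero                   (suc (suc zero))       = oi≈0 zero (suc zero)
  off-blocks≈0⇒≋blockMat M oi≈0 io≈0 zero                   (suc (suc (suc zero))) = refl
  off-blocks≈0⇒≋blockMat M oi≈0 io≈0 (suc zero)             zero                   = io≈0 zero zero
  off-blocks≈0⇒≋blockMat M oi≈0 io≈0 (suc zero)             (suc zero)             = refl
  off-blocks≈0⇒≋blockMat M oi≈0 io≈0 (suc zero)             (suc (suc zero))       = refl
  off-blocks≈0⇒≋blockMat M oi≈0 io≈0 (suc zero)             (suc (suc (suc zero))) = io≈0 zero (suc zero)
  off-blocks≈0⇒≋blockMat M oi≈0 io≈0 (suc (suc zero))       zero                   = io≈0 (suc zero) zero
  off-blocks≈0⇒≋blockMat M oi≈0 io≈0 (suc (suc zero))       (suc zero)             = refl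
  off-blocks≈0⇒≋blockMat M oi≈0 io≈0 (suc (suc zero))       (suc (suc zero))       = refl
  off-blocks≈0⇒≋blockMat M oi≈0 io≈0 (suc (suc zero))       (suc (suc (suc zero))) = io≈0 (suc zero) (suc zero)
  off-blocks≈0⇒≋blockMat M oi≈0 io≈0 (suc (suc (suc zero))) zero                   = refl
  off-blocks≈0⇒≋blockMat M oi≈0 io≈0 (suc (suc (suc zero))) (suc zero)             = oi≈0 (suc zero) zero
  off-blocks≈0⇒≋blockMat M oi≈0 io≈0 (suc (suc (suc zero))) (suc (suc zero))       = oi≈0 (suc zero) (suc zero)
  off-blocks≈0⇒≋blockMat M oi≈0 io≈0 (suc (suc (suc zero))) (suc (suc (suc zero))) = refl

  block-outer-I : block outer I ≋₂ 1₂
  block-outer-I zero       zero       = refl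
  block-outer-I zero       (suc zero) = refl
  block-outer-I (suc zero) zero       = refl
  block-outer-I (suc zero) (suc zero) = refl

  block-inner-I : block inner I ≋₂ 1₂
  block-inner-I zero       zero       = refl
  block-inner-I zero       (suc zero) = refl
  block-inner-I (suc zero) zero       = refl
  block-inner-I (suc zero) (suc zero) = refl

  I-outer-inner : ∀ i j → I (outer i) (inner j) ≈ 0#
  I-outer-inner zero       zero       = refl
  I-outer-inner zero       (suc zero) = refl
  I-outer-inner (suc zero) zero       = refl
  I-outer-inner (suc zero) (suc zero) = refl

  I-inner-outer : ∀ i j → I (inner i) (outer j) ≈ 0#
  I-inner-outer zero       zero       = refl
  I-inner-outer zero       (suc zero) = refl
  I-inner-outer (suc zero) zero       = refl
  I-inner-outer (suc zero) (suc zero) = refl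

  blockMat-·-outer : ∀ G N i j →
                     (blockMat G · N) (outer i) (outer j) ≈ (block outer (blockMat G) ⊗ block outer N) i j
  blockMat-·-outer G N zero       j = p+0q+0r+s≈p+s _ _ _ _
  blockMat-·-outer G N (suc zero) j = p+0q+0r+s≈p+s _ _ _ _

  blockMat-·-inner : ∀ G N i j →
                     (blockMat G · N) (inner i) (inner j) ≈ (block inner (blockMat G) ⊗ block inner N) i j
  blockMat-·-inner G N zero       j = 0p+q+r+0s≈q+r _ _ _ _
  blockMat-·-inner G N (suc zero) j = 0p+q+r+0s≈q+r _ _ _ _

  ·-blockMat-outer : ∀ M G r j → (M · blockMat G) r (outer j) ≈ ((M r ∘ outer) ⊙ block outer (blockMat G)) j
  ·-blockMat-outer M G r zero       = p+q0+r0+s≈p+s _ _ _ _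
  ·-blockMat-outer M G r (suc zero) = p+q0+r0+s≈p+s _ _ _ _

  ·-blockMat-inner : ∀ M G r j → (M · blockMat G) r (inner j) ≈ ((M r ∘ inner) ⊙ block inner (blockMat G)) j
  ·-blockMat-inner M G r zero       = p0+q+r+s0≈q+r _ _ _ _
  ·-blockMat-inner M G r (suc zero) = p0+q+r+s0≈q+r _ _ _ _

  module _ (G : Sig) (B : Mat) (AB≈I : (blockMat G · B) ≋ I) where

    outer-block-inverse : (block outer (blockMat G) ⊗ block outer B) ≋₂ 1₂
    outer-block-inverse i j =
      trans (sym (blockMat-·-outer G B i j)) (trans (AB≈I (outer i) (outer j)) (block-outer-I i j))

    inner-block-inverse : (block inner (blockMat G) ⊗ block inner B) ≋₂ 1₂
    inner-block-inverse i j =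
      trans (sym (blockMat-·-inner G B i j)) (trans (AB≈I (inner i) (inner j)) (block-inner-I i j))

    module _ (BA≈I : (B · blockMat G) ≋ I) where

      outer-inner-zero : ∀ i k → B (outer i) (inner k) ≈ 0#
      outer-inner-zero i =
        vM≈0⇒v≈0 {block inner (blockMat G)} {block inner B} inner-block-inverse (B (outer i) ∘ inner) λ j →
          trans (sym (·-blockMat-inner B G (outer i) j)) (trans (BA≈I (outer i) (inner j)) (I-outer-inner i j))

      inner-outer-zero : ∀ i k → B (inner i) (outer k) ≈ 0#
      inner-outer-zero i =
        vM≈0⇒v≈0 {block outer (blockMat G)} {block outer B} outer-block-inverse (B (inner i) ∘ outer) λ j →
          trans (sym (·-blockMat-outer B G (inner i) j)) (trans (BA≈I (inner i) (outer j)) (I-inner-outer i j))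

    -- outerDet g is definitionally the determinant of the outer block of blockMat g; innerDet g
    -- lists the factors of its diagonal product in the other order.
    outerDet*outerDet≈1 : outerDet G * outerDet (signatureOf B) ≈ 1#
    outerDet*outerDet≈1 = det*det≈1 (block outer (blockMat G)) (block outer B) outer-block-inverse

    innerDet*innerDet≈1 : innerDet G * innerDet (signatureOf B) ≈ 1#
    innerDet*innerDet≈1 = trans (*-cong (innerDet≈det G) (innerDet≈det (signatureOf B)))
                                (det*det≈1 (block inner (blockMat G)) (block inner B) inner-block-inverse)
      where
      innerDet≈det : ∀ g → innerDet g ≈ det (block inner (blockMat g))
      innerDet≈det g = +-cong (*-comm _ _) refl

  applySign-inverse : ∀ s {D d D′ d′} → D ≈ applySign s D′ → D * d ≈ 1# → D′ * d′ ≈ 1# → d ≈ applySign s d′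
  applySign-inverse Sign.+ D≈D′ Dd≈1 D′d′≈1 = *-inverse-unique Dd≈1 (trans (*-congʳ D≈D′) D′d′≈1)
  applySign-inverse Sign.- D≈-D′ Dd≈1 D′d′≈1 =
    *-inverse-unique Dd≈1 (trans (*-congʳ D≈-D′) (trans ([-x][-y]≈xy _ _) D′d′≈1))

lemma5p4 : ∀ {c ℓ} (F : Field c ℓ) → let open FieldDefs F in
    (G : Sig) (s : Sign) (B : Mat) →
    IsInverse (blockMat G) B →
    outerDet G ≈ applySign s (innerDet G) →
    Σ[ g ∈ Sig ] (B ≋ blockMat g × outerDet g ≈ applySign s (innerDet g))
lemma5p4 F G s B (AB≈I , BA≈I) outerDet≈±innerDet =
  signatureOf B ,
  off-blocks≈0⇒≋blockMat B (outer-inner-zero G B AB≈I BA≈I) (inner-outer-zero G B AB≈I BA≈I) ,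
  applySign-inverse s outerDet≈±innerDet (outerDet*outerDet≈1 G B AB≈I) (innerDet*innerDet≈1 G B AB≈I)
  where open BlockMatrix F
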